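{- In Algorithm I (see context), the net increase of the dual objective $\sum_j y_j$ caused by the dual update for constraint $h$ is at least $\tfrac12\,d_{m(h)}\,t_h$.
   Context: Online covering LP without upper bounds: $n$ variables with costs $c_i>0$; constraints $\sum_{i=1}^n a_{ij}x_i\ge 1$ ($a_{ij}\ge 0$) arrive one at a time, $j=1,2,\dots$; $T_j=\{i:a_{ij}>0\}$, assumed nonempty; $a_{ij}=0$ for $i\notin T_j$. $\log=\log_2$. Algorithm I maintains $x\in\mathbb{R}^n_{\ge0}$ (initially $0$) and dual values $y_j\ge0$ for arrived constraints. When constraint $h$ arrives: set $k$ to the smallest power of $2$ at least $\max\{2,|T_1|,\dots,|T_h|\}$; let $d_{ih}=c_i/a_{ih}$ for $i\in T_h$, $d_{m(h)}=\min_{i\in T_h}d_{ih}$. Primal update: while $\sum_ia_{ih}x_i<1$, replace simultaneously for all $i\in T_h$: $x_i\leftarrow(1+d_{m(h)}/d_{ih})x_i+\frac{1}{ka_{ih}}\frac{d_{m(h)}}{d_{ih}}$; $t_h$ is the number of iterations. Dual update: if $t_h=0$, set $y_h=0$ and change nothing else. Otherwise (a) set $y_h\leftarrow d_{m(h)}t_h$; (b) for each $i\in T_h$ (in any order, each time using the current $y$-values): (i) if $\sum_{j<h}a_{ij}y_j\le(10\log k)c_i$, do nothing; (ii) otherwise let $k_i<h$ be the largest index with $\sum_{j\le k_i}a_{ij}y_j\le(5\log k)c_i$, let $P_i=\{j\le k_i: i\in T_j\}$, and for every $j\in P_i$ set $y_j\leftarrow(1-d_{m(h)}/d_{ih})\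,y_j$.
   Formalization: The costs $c_i$ and coefficients $a_{ij}$ are rational, so the primal vector x and the dual values $y_j$ of Algorithm I are rational as well. -}

module Defs where

open import Data.Nat as ℕ using (ℕ; zero; suc; _⊔_; _^_)
open import Data.Nat.Logarithm using (⌈log₂_⌉)
open import Data.Integer using (+_)
open import Data.Fin using (Fin)
open import Data.Bool using (if_then_else_)
open import Data.List using (List; []; _∷_; filter; length; allFin; foldr; foldl)
open import Data.List.Relation.Binary.Permutation.Propositional using (_↭_)
open import Data.Rational using (ℚ; 0ℚ; 1ℚ; _+_; _*_; _-_; _⊓_; _<_; _≤_; _/_; 1/_; ≢-nonZero)
open import Data.Rational.Properties using (_≟_; _<?_; _≤?_)
open import Data.Product using (_×_)
open import Relation.Nullary using (yes; no)
open import Relation.Nullary.Decidable using (⌊_⌋)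

-- Total reciprocal on ℚ (inv 0 = 0); only ever applied to nonzero values
-- in the algorithm below.
inv : ℚ → ℚ
inv p with p ≟ 0ℚ
... | yes _ = 0ℚ
... | no p≢0 = 1/_ p {{≢-nonZero p≢0}}

ℕ→ℚ : ℕ → ℚ
ℕ→ℚ m = + m / 1

sumℚ : List ℚ → ℚ
sumℚ = foldr _+_ 0ℚ

Σ< : ℕ → (ℕ → ℚ) → ℚ
Σ< zero    f = 0ℚ
Σ< (suc m) f = Σ< m f + f m

-- minimum of f over a list (value for the empty list irrelevant: T_h ≠ ∅)
minOver : {A : Set} → List A → (A → ℚ) → ℚ
minOver []           f = 0ℚ
minOver (i ∷ [])     f = f i
minOver (i ∷ j ∷ l)  f = f i ⊓ minOver (j ∷ l) f

iter : {A : Set} → ℕ → (A → A) → A → A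
iter zero    g x = x
iter (suc m) g x = g (iter m g x)

-- Constraints are indexed 0,1,2,… (constraint number j here is the
-- paper's constraint j+1);  a h i  is the paper's a_{i,h+1}.
module AlgorithmI (n : ℕ) (c : Fin n → ℚ) (a : ℕ → Fin n → ℚ) where

  T : ℕ → List (Fin n)
  T h = filter (λ i → 0ℚ <? a h i) (allFin n)

  maxT : ℕ → ℕ
  maxT zero    = 2 ⊔ length (T zero)
  maxT (suc h) = maxT h ⊔ length (T (suc h))

  logk : ℕ → ℕ
  logk h = ⌈log₂ (maxT h) ⌉

  k : ℕ → ℕ
  k h = 2 ^ logk h

  d : ℕ → Fin n → ℚ
  d h i = c i * inv (a h i)

  dm : ℕ → ℚ
  dm h = minOver (T h) (d h)

  cover : ℕ → (Fin n → ℚ) → ℚ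
  cover h x = sumℚ (Data.List.map (λ i → a h i * x i) (allFin n))

  primalStep : ℕ → (Fin n → ℚ) → (Fin n → ℚ)
  primalStep h x i =
    if ⌊ 0ℚ <? a h i ⌋
    then (1ℚ + dm h * inv (d h i)) * x i
           + inv (ℕ→ℚ (k h) * a h i) * (dm h * inv (d h i))
    else x i

  -- t is the number of iterations of the while loop started at x
  PrimalRun : ℕ → (Fin n → ℚ) → ℕ → Set
  PrimalRun h x t =
    ((s : ℕ) → s ℕ.< t → cover h (iter s (primalStep h) x) < 1ℚ)
    × (1ℚ ≤ cover h (iter t (primalStep h) x))

  -- largest L ≤ m with Σ_{j<L} a_{ij} y_j ≤ bound  (L = 0 always qualifies);
  -- the paper's k_i (1-based) equals this L, and P_i = {j < L : i ∈ T_j}.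
  largestPrefix : Fin n → (ℕ → ℚ) → ℚ → ℕ → ℕ
  largestPrefix i y b zero    = zero
  largestPrefix i y b (suc m) =
    if ⌊ Σ< (suc m) (λ j → a j i * y j) ≤? b ⌋
    then suc m
    else largestPrefix i y b m

  dualStepI : ℕ → (ℕ → ℚ) → Fin n → (ℕ → ℚ)
  dualStepI h y i =
    if ⌊ Σ< h (λ j → a j i * y j) ≤? ℕ→ℚ (10 ℕ.* logk h) * c i ⌋
    then y
    else (λ j → if ⌊ j ℕ.<? largestPrefix i y (ℕ→ℚ (5 ℕ.* logk h) * c i) h ⌋
                     Data.Bool.∧ ⌊ 0ℚ <? a j i ⌋
                then (1ℚ - dm h * inv (d h i)) * y j
                else y j)

  setAt : (ℕ → ℚ) → ℕ → ℚ → (ℕ → ℚ)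
  setAt y h v j = if ⌊ j ℕ.≟ h ⌋ then v else y j

  -- the whole dual update for constraint h, with t = t_h and the
  -- elements of T_h processed in the order given by the list ord
  dualUpdate : ℕ → ℕ → List (Fin n) → (ℕ → ℚ) → (ℕ → ℚ)
  dualUpdate h zero    ord y = y
  dualUpdate h (suc t) ord y =
    foldl (dualStepI h) (setAt y h (dm h * ℕ→ℚ (suc t))) ord

  -- Reach h x y : (x, y) is a possible state of Algorithm I after the
  -- constraints 0, …, h-1 have been processed (any processing orders).
  data Reach : ℕ → (Fin n → ℚ) → (ℕ → ℚ) → Set where
    start : Reach zero (λ _ → 0ℚ) (λ _ → 0ℚ)
    next  : ∀ {h x y} (t : ℕ) (ord : List (Fin n)) →
            Reach h x y → PrimalRun h x t → ord ↭ T h →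
            Reach (suc h) (iter t (primalStep h) x) (dualUpdate h t ord y)

module Submission where

-- Step (a) adds d_{m(h)} t; each of the |T_h| ≤ k executions of step (b)(ii)
-- removes at most d_{m(h)} / 2k, so the dual update loses at most d_{m(h)} / 2.
-- The bound on one removal rests on an invariant of the algorithm: for every
-- variable i and every cut L ≤ h,
--     k c_i x_i ≥ (Σ_{j<L, i∈T_j} y_j) · 2^(Σ_{L≤j<h} a_{ij} y_j / c_i),
-- since every unit of load a_{ih} y_h / c_i is matched by primal steps that
-- multiply x_i by 1 + ρ, where ρ = d_{m(h)} / d_{ih}.  When step (b)(ii) fires
-- for i, the load after the cut k_i is at least 5 log k, so the weight before
-- the cut is at most c_i x_i / 2k, and scaling it by 1 - ρ loses at most
-- ρ c_i x_i / 2k = d_{m(h)} a_{ih} x_i / 2k ≤ d_{m(h)} / 2k.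

open import Defs
open import Data.Nat as ℕ using (ℕ; zero; suc; z≤n; s≤s)
import Data.Nat.Properties as ℕP
open import Data.Nat.Logarithm using (⌈log₂_⌉; ⌈log₂⌉-mono-≤)
open import Data.Nat.Logarithm.Core using (⌈log2⌉)
open import Induction.WellFounded using (acc)
import Data.Integer as ℤ
import Data.Integer.Properties as ℤP
open import Data.Nat.Coprimality using (1-coprimeTo) renaming (sym to coprime-sym)
open import Data.Fin using (Fin)
open import Data.Bool using (Bool; true; false; if_then_else_; _∧_)
open import Data.List using (List; []; _∷_; map; length; allFin; foldl)
open import Data.List.Membership.Propositional using (_∈_)
open import Data.List.Membership.Propositional.Properties using (∈-filter⁻; ∈-filter⁺; ∈-allFin)
open import Data.List.Relation.Binary.Permutation.Propositional using (_↭_)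
open import Data.List.Relation.Binary.Permutation.Propositional.Properties using (∈-resp-↭; ↭-length)
open import Data.Product using (proj₁; proj₂; ∃)
open import Data.Sum using (_⊎_; inj₁; inj₂)
open import Data.List.Relation.Unary.Any using (here; there)
open import Data.Rational
  using (ℚ; mkℚ; 0ℚ; 1ℚ; ½; _+_; _*_; _-_; -_; _⊓_; _<_; _≤_; _/_; *≤*; ≢-nonZero; positive; nonNegative)
open import Data.Rational.Properties
open import Data.Rational.Solver using (module +-*-Solver)
open import Data.Empty using (⊥-elim)
open import Relation.Nullary using (¬_; Dec; yes; no)
open import Relation.Nullary.Decidable using (⌊_⌋; toWitness)
open import Relation.Binary.PropositionalEquality
  using (_≡_; _≢_; refl; sym; trans; cong; cong₂; subst; subst₂)

open +-*-Solver
open ≤-Reasoning hiding (start)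

-- Sign-conditioned monotonicity of multiplication, with the sign conditions
-- as ordinary hypotheses (the library takes them as instance arguments).

*-monoʳ-≤-0≤ : ∀ {p q} r → 0ℚ ≤ r → p ≤ q → p * r ≤ q * r
*-monoʳ-≤-0≤ r 0≤r = *-monoʳ-≤-nonNeg r {{nonNegative 0≤r}}

*-monoˡ-≤-0≤ : ∀ {p q} r → 0ℚ ≤ r → p ≤ q → r * p ≤ r * q
*-monoˡ-≤-0≤ r 0≤r = *-monoˡ-≤-nonNeg r {{nonNegative 0≤r}}

*-cancelʳ-≤-0< : ∀ {p q} r → 0ℚ < r → p * r ≤ q * r → p ≤ q
*-cancelʳ-≤-0< r 0<r = *-cancelʳ-≤-pos r {{positive 0<r}}

0≤* : ∀ {p q} → 0ℚ ≤ p → 0ℚ ≤ q → 0ℚ ≤ p * q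
0≤* {p} {q} 0≤p 0≤q =
  nonNegative⁻¹ (p * q) {{nonNeg*nonNeg⇒nonNeg p {{nonNegative 0≤p}} q {{nonNegative 0≤q}}}}

0<* : ∀ {p q} → 0ℚ < p → 0ℚ < q → 0ℚ < p * q
0<* {p} {q} 0<p 0<q = positive⁻¹ (p * q) {{pos*pos⇒pos p {{positive 0<p}} q {{positive 0<q}}}}

0≤+ : ∀ {p q} → 0ℚ ≤ p → 0ℚ ≤ q → 0ℚ ≤ p + q
0≤+ = +-mono-≤

0<1 : 0ℚ < 1ℚ
0<1 = toWitness {a? = 0ℚ <? 1ℚ} _

0≤1 : 0ℚ ≤ 1ℚ
0≤1 = <⇒≤ 0<1

p≤q⇒0≤q-p : ∀ {p q} → p ≤ q → 0ℚ ≤ q - p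
p≤q⇒0≤q-p {p} {q} p≤q = subst (_≤ q - p) (+-inverseʳ p) (+-monoˡ-≤ (- p) p≤q)

0≤q-p⇒p≤q : ∀ {p q} → 0ℚ ≤ q - p → p ≤ q
0≤q-p⇒p≤q {p} {q} 0≤q-p = begin
  p             ≡⟨ sym (+-identityʳ p) ⟩
  p + 0ℚ        ≤⟨ +-monoʳ-≤ p 0≤q-p ⟩
  p + (q - p)   ≡⟨ solve 2 (λ p q → p :+ (q :- p) := q) refl p q ⟩
  q             ∎

[p-p]*q≡0 : ∀ p q → (p - p) * q ≡ 0ℚ
[p-p]*q≡0 p q = trans (cong (_* q) (+-inverseʳ p)) (*-zeroˡ q)

remainder-≥ : ∀ {u v B} → B + B ≤ u + v → u ≤ B → B ≤ v
remainder-≥ {u} {v} {B} 2B≤u+v u≤B = 0≤q-p⇒p≤q (subst (0ℚ ≤_) identity (0≤+ (p≤q⇒0≤q-p 2B≤u+v) (p≤q⇒0≤q-p u≤B)))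
  where
  identity : u + v - (B + B) + (B - u) ≡ v - B
  identity = solve 3 (λ u v B → u :+ v :- (B :+ B) :+ (B :- u) := v :- B) refl u v B

half-retained : ∀ {D Δ} → Δ + Δ ≤ D → ½ * D ≤ D - Δ
half-retained {D} {Δ} 2Δ≤D = 0≤q-p⇒p≤q (subst (0ℚ ≤_) identity (0≤* 0≤½ (p≤q⇒0≤q-p 2Δ≤D)))
  where
  0≤½ : 0ℚ ≤ ½
  0≤½ = <⇒≤ (toWitness {a? = 0ℚ <? ½} _)
  identity : ½ * (D - (Δ + Δ)) ≡ D - Δ - ½ * D
  identity = solve 2 (λ D Δ → con ½ :* (D :- (Δ :+ Δ)) := D :- Δ :- con ½ :* D) refl D Δ

inv-inverseˡ : ∀ {p} → 0ℚ < p → inv p * p ≡ 1ℚ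
inv-inverseˡ {p} 0<p with p ≟ 0ℚ
... | yes p≡0 = ⊥-elim (<-irrefl (sym p≡0) 0<p)
... | no p≢0  = *-inverseˡ p {{≢-nonZero p≢0}}

inv-pos : ∀ {p} → 0ℚ < p → 0ℚ < inv p
inv-pos {p} 0<p with p ≟ 0ℚ
... | yes p≡0 = ⊥-elim (<-irrefl (sym p≡0) 0<p)
... | no p≢0  = positive⁻¹ _ {{1/pos⇒pos p {{positive 0<p}}}}

ℕ→ℚ-mkℚ : ∀ m → ℕ→ℚ m ≡ mkℚ (ℤ.+ m) 0 (coprime-sym (1-coprimeTo m))
ℕ→ℚ-mkℚ m = normalize-coprime {m} {0} (coprime-sym (1-coprimeTo m))

ℕ→ℚ-+ : ∀ m n → ℕ→ℚ (m ℕ.+ n) ≡ ℕ→ℚ m + ℕ→ℚ n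
ℕ→ℚ-+ m n rewrite ℕ→ℚ-mkℚ m | ℕ→ℚ-mkℚ n =
  cong (_/ 1) (sym (cong₂ ℤ._+_ (ℤP.*-identityʳ (ℤ.+ m)) (ℤP.*-identityʳ (ℤ.+ n))))

ℕ→ℚ-* : ∀ m n → ℕ→ℚ (m ℕ.* n) ≡ ℕ→ℚ m * ℕ→ℚ n
ℕ→ℚ-* m n rewrite ℕ→ℚ-mkℚ m | ℕ→ℚ-mkℚ n = cong (_/ 1) (ℤP.pos-* m n)

ℕ→ℚ-mono : ∀ {m n} → m ℕ.≤ n → ℕ→ℚ m ≤ ℕ→ℚ n
ℕ→ℚ-mono {m} {n} m≤n rewrite ℕ→ℚ-mkℚ m | ℕ→ℚ-mkℚ n =
  *≤* (subst₂ ℤ._≤_ (sym (ℤP.*-identityʳ (ℤ.+ m))) (sym (ℤP.*-identityʳ (ℤ.+ n))) (ℤ.+≤+ m≤n))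

ℕ→ℚ-suc : ∀ m → ℕ→ℚ (suc m) ≡ 1ℚ + ℕ→ℚ m
ℕ→ℚ-suc m = ℕ→ℚ-+ 1 m

ℕ→ℚ-nonNeg : ∀ m → 0ℚ ≤ ℕ→ℚ m
ℕ→ℚ-nonNeg m = ℕ→ℚ-mono {0} {m} z≤n

ℕ→ℚ-≤0 : ∀ m → ℕ→ℚ m ≤ 0ℚ → m ≡ 0
ℕ→ℚ-≤0 zero    _     = refl
ℕ→ℚ-≤0 (suc m) m≤0 = ⊥-elim (<-irrefl refl (<-≤-trans 0<1 (≤-trans (ℕ→ℚ-mono {1} {suc m} (s≤s z≤n)) m≤0)))

pow2 : ℕ → ℚ
pow2 m = ℕ→ℚ (2 ℕ.^ m)

pow2-nonNeg : ∀ m → 0ℚ ≤ pow2 m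
pow2-nonNeg m = ℕ→ℚ-nonNeg (2 ℕ.^ m)

pow2-suc : ∀ m → pow2 (suc m) ≡ pow2 m + pow2 m
pow2-suc m = trans (cong (λ e → ℕ→ℚ (2 ℕ.^ m ℕ.+ e)) (ℕP.+-identityʳ (2 ℕ.^ m)))
                   (ℕ→ℚ-+ (2 ℕ.^ m) (2 ℕ.^ m))

pow2-double : ∀ l → pow2 (l ℕ.+ l) ≡ pow2 l * pow2 l
pow2-double l = trans (cong ℕ→ℚ (ℕP.^-distribˡ-+-* 2 l l)) (ℕ→ℚ-* (2 ℕ.^ l) (2 ℕ.^ l))

⊓1-+ : ∀ v r → 0ℚ ≤ r → (v + r) ⊓ 1ℚ ≤ v ⊓ 1ℚ + r
⊓1-+ v r 0≤r with v ≤? 1ℚ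
... | yes v≤1 = begin
  (v + r) ⊓ 1ℚ  ≤⟨ p⊓q≤p (v + r) 1ℚ ⟩
  v + r         ≡⟨ cong (_+ r) (sym (p≤q⇒p⊓q≡p v≤1)) ⟩
  v ⊓ 1ℚ + r    ∎
... | no v≰1 = begin
  (v + r) ⊓ 1ℚ  ≤⟨ p⊓q≤q (v + r) 1ℚ ⟩
  1ℚ            ≡⟨ sym (+-identityʳ 1ℚ) ⟩
  1ℚ + 0ℚ       ≤⟨ +-monoʳ-≤ 1ℚ 0≤r ⟩
  1ℚ + r        ≡⟨ cong (_+ r) (sym (p≥q⇒p⊓q≡q (<⇒≤ (≰⇒> v≰1)))) ⟩
  v ⊓ 1ℚ + r    ∎

1+[u+r]≤[1+r][1+u] : ∀ {u r} → 0ℚ ≤ u → 0ℚ ≤ r → 1ℚ + (u + r) ≤ (1ℚ + r) * (1ℚ + u)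
1+[u+r]≤[1+r][1+u] {u} {r} 0≤u 0≤r = 0≤q-p⇒p≤q (subst (0ℚ ≤_) identity (0≤* 0≤r 0≤u))
  where
  identity : r * u ≡ (1ℚ + r) * (1ℚ + u) - (1ℚ + (u + r))
  identity = solve 2 (λ r u → r :* u := (con 1ℚ :+ r) :* (con 1ℚ :+ u) :- (con 1ℚ :+ (u :+ r))) refl r u

2[u+r]≤[1+r][1+u] : ∀ {u r} → u ≤ 1ℚ → r ≤ 1ℚ → (u + r) + (u + r) ≤ (1ℚ + r) * (1ℚ + u)
2[u+r]≤[1+r][1+u] {u} {r} u≤1 r≤1 =
  0≤q-p⇒p≤q (subst (0ℚ ≤_) identity (0≤* (p≤q⇒0≤q-p u≤1) (p≤q⇒0≤q-p r≤1)))
  where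
  identity : (1ℚ - u) * (1ℚ - r) ≡ (1ℚ + r) * (1ℚ + u) - ((u + r) + (u + r))
  identity = solve 2 (λ r u → (con 1ℚ :- u) :* (con 1ℚ :- r)
                             := (con 1ℚ :+ r) :* (con 1ℚ :+ u) :- ((u :+ r) :+ (u :+ r))) refl r u

-- ExpBound A S Y  says  A · 2^S ≤ Y  for a rational exponent S ≥ 0, where 2^S
-- is replaced by its piecewise linear interpolation 2^m (1 + (S - m)) between
-- consecutive integers m ≤ S < m + 1 (which is at least 2^S).  Quantifying over all integers m ≤ S
-- (with S - m capped at 1) avoids taking floors.  Multiplying Y by 1 + r
-- allows the exponent to advance by r ∈ [0, 1]  (expBound-step), which is how
-- the multiplicative primal update drives the exponential growth of x_i.
ExpBound : ℚ → ℚ → ℚ → Set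
ExpBound A S Y = ∀ m → ℕ→ℚ m ≤ S → A * pow2 m * (1ℚ + (S - ℕ→ℚ m) ⊓ 1ℚ) ≤ Y

expBound-step-within : ∀ {A S Y r} m → 0ℚ ≤ A → 0ℚ ≤ r → ExpBound A S Y → ℕ→ℚ m ≤ S →
  A * pow2 m * (1ℚ + (S + r - ℕ→ℚ m) ⊓ 1ℚ) ≤ (1ℚ + r) * Y
expBound-step-within {A} {S} {Y} {r} m 0≤A 0≤r bound m≤S = begin
  B * (1ℚ + (S + r - M) ⊓ 1ℚ)   ≤⟨ *-monoˡ-≤-0≤ B 0≤B (+-monoʳ-≤ 1ℚ cap) ⟩
  B * (1ℚ + (u + r))            ≤⟨ *-monoˡ-≤-0≤ B 0≤B (1+[u+r]≤[1+r][1+u] 0≤u 0≤r) ⟩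
  B * ((1ℚ + r) * (1ℚ + u))      ≡⟨ solve 3 (λ B r u → B :* ((con 1ℚ :+ r) :* (con 1ℚ :+ u))
                                             := (con 1ℚ :+ r) :* (B :* (con 1ℚ :+ u))) refl B r u ⟩
  (1ℚ + r) * (B * (1ℚ + u))      ≤⟨ *-monoˡ-≤-0≤ (1ℚ + r) (0≤+ 0≤1 0≤r) (bound m m≤S) ⟩
  (1ℚ + r) * Y                  ∎
  where
  M = ℕ→ℚ m
  B = A * pow2 m
  u = (S - M) ⊓ 1ℚ
  0≤B : 0ℚ ≤ B
  0≤B = 0≤* 0≤A (pow2-nonNeg m)
  0≤u : 0ℚ ≤ u
  0≤u = ⊓-glb (p≤q⇒0≤q-p m≤S) 0≤1
  cap : (S + r - M) ⊓ 1ℚ ≤ u + r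
  cap = subst (λ e → e ⊓ 1ℚ ≤ u + r) (solve 3 (λ S M r → (S :- M) :+ r := S :+ r :- M) refl S M r)
              (⊓1-+ (S - M) r 0≤r)

-- The case of expBound-step where the exponent crosses the integer m + 1:
-- the factor 2 gained in 2^(m+1) is paid for by  2(v + r) ≤ (1 + r)(1 + v).
expBound-step-across : ∀ {A S Y r} m → 0ℚ ≤ A → 0ℚ ≤ r → r ≤ 1ℚ → ExpBound A S Y →
  ℕ→ℚ m ≤ S → S < ℕ→ℚ (suc m) →
  A * pow2 (suc m) * (1ℚ + (S + r - ℕ→ℚ (suc m)) ⊓ 1ℚ) ≤ (1ℚ + r) * Y
expBound-step-across {A} {S} {Y} {r} m 0≤A 0≤r r≤1 bound m≤S S<m+1 = begin
  A * pow2 (suc m) * (1ℚ + (S + r - ℕ→ℚ (suc m)) ⊓ 1ℚ)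
    ≤⟨ *-monoˡ-≤-0≤ (A * pow2 (suc m)) (0≤* 0≤A (pow2-nonNeg (suc m)))
                    (+-monoʳ-≤ 1ℚ (p⊓q≤p (S + r - ℕ→ℚ (suc m)) 1ℚ)) ⟩
  A * pow2 (suc m) * (1ℚ + (S + r - ℕ→ℚ (suc m)))
    ≡⟨ cong₂ (λ p q → A * p * (1ℚ + (S + r - q))) (pow2-suc m) (ℕ→ℚ-suc m) ⟩
  A * (P + P) * (1ℚ + (S + r - (1ℚ + M)))
    ≡⟨ solve 5 (λ A P S r M → A :* (P :+ P) :* (con 1ℚ :+ (S :+ r :- (con 1ℚ :+ M)))
                             := A :* P :* ((S :- M :+ r) :+ (S :- M :+ r))) refl A P S r M ⟩
  B * ((v + r) + (v + r))        ≤⟨ *-monoˡ-≤-0≤ B 0≤B (2[u+r]≤[1+r][1+u] v≤1 r≤1) ⟩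
  B * ((1ℚ + r) * (1ℚ + v))      ≡⟨ solve 3 (λ B r u → B :* ((con 1ℚ :+ r) :* (con 1ℚ :+ u))
                                             := (con 1ℚ :+ r) :* (B :* (con 1ℚ :+ u))) refl B r v ⟩
  (1ℚ + r) * (B * (1ℚ + v))      ≡⟨ cong (λ e → (1ℚ + r) * (B * (1ℚ + e))) (sym (p≤q⇒p⊓q≡p v≤1)) ⟩
  (1ℚ + r) * (B * (1ℚ + v ⊓ 1ℚ)) ≤⟨ *-monoˡ-≤-0≤ (1ℚ + r) (0≤+ 0≤1 0≤r) (bound m m≤S) ⟩
  (1ℚ + r) * Y                  ∎
  where
  M = ℕ→ℚ m
  P = pow2 m
  B = A * P
  v = S - M
  0≤B : 0ℚ ≤ B
  0≤B = 0≤* 0≤A (pow2-nonNeg m)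
  v≤1 : v ≤ 1ℚ
  v≤1 = 0≤q-p⇒p≤q (subst (0ℚ ≤_) (solve 3 (λ S M o → (o :+ M) :- S := o :- (S :- M)) refl S M 1ℚ)
                                  (p≤q⇒0≤q-p (<⇒≤ (subst (S <_) (ℕ→ℚ-suc m) S<m+1))))

expBound-step : ∀ {A S Y r} → 0ℚ ≤ A → 0ℚ ≤ S → 0ℚ ≤ r → r ≤ 1ℚ →
                ExpBound A S Y → ExpBound A (S + r) ((1ℚ + r) * Y)
expBound-step {A} {S} {Y} {r} 0≤A 0≤S 0≤r r≤1 bound m m≤S+r with ℕ→ℚ m ≤? S
... | yes m≤S = expBound-step-within m 0≤A 0≤r bound m≤S
... | no m≰S with m
...   | zero   = ⊥-elim (m≰S 0≤S)
...   | suc m′ = expBound-step-across m′ 0≤A 0≤r r≤1 bound m′≤S (≰⇒> m≰S)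
  where
  -- from  m′ + 1 ≤ S + r ≤ S + 1
  m′≤S : ℕ→ℚ m′ ≤ S
  m′≤S = 0≤q-p⇒p≤q (subst (0ℚ ≤_) (solve 3 (λ S M o → (S :+ o) :- (o :+ M) := S :- M) refl S (ℕ→ℚ m′) 1ℚ)
           (p≤q⇒0≤q-p (≤-trans (subst (_≤ S + r) (ℕ→ℚ-suc m′) m≤S+r) (+-monoʳ-≤ S r≤1))))

expBound-raise : ∀ {A S Y Y′} → Y ≤ Y′ → ExpBound A S Y → ExpBound A S Y′
expBound-raise Y≤Y′ bound m m≤S = ≤-trans (bound m m≤S) Y≤Y′

expBound-weaken : ∀ {A A′ S S′ Y} → 0ℚ ≤ A′ → A′ ≤ A → S′ ≤ S → ExpBound A S Y → ExpBound A′ S′ Y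
expBound-weaken {A} {A′} {S} {S′} {Y} 0≤A′ A′≤A S′≤S bound m m≤S′ = begin
  A′ * pow2 m * (1ℚ + (S′ - M) ⊓ 1ℚ)
    ≤⟨ *-monoˡ-≤-0≤ (A′ * pow2 m) (0≤* 0≤A′ (pow2-nonNeg m))
                    (+-monoʳ-≤ 1ℚ (⊓-monoˡ-≤ 1ℚ (+-monoˡ-≤ (- M) S′≤S))) ⟩
  A′ * pow2 m * (1ℚ + (S - M) ⊓ 1ℚ)
    ≤⟨ *-monoʳ-≤-0≤ (1ℚ + (S - M) ⊓ 1ℚ) (0≤+ 0≤1 (⊓-glb (p≤q⇒0≤q-p m≤S) 0≤1))
                    (*-monoʳ-≤-0≤ (pow2 m) (pow2-nonNeg m) A′≤A) ⟩
  A * pow2 m * (1ℚ + (S - M) ⊓ 1ℚ)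
    ≤⟨ bound m m≤S ⟩
  Y ∎
  where
  M = ℕ→ℚ m
  m≤S = ≤-trans m≤S′ S′≤S

expBound-zero : ∀ {A Y} → A ≤ Y → ExpBound A 0ℚ Y
expBound-zero {A} {Y} A≤Y m m≤0 with ℕ→ℚ-≤0 m m≤0
... | refl = subst (_≤ Y) (sym (trans (*-identityʳ (A * 1ℚ)) (*-identityʳ A))) A≤Y

expBound-zero⁻¹ : ∀ {A Y} → ExpBound A 0ℚ Y → A ≤ Y
expBound-zero⁻¹ {A} {Y} bound = subst (_≤ Y) (trans (*-identityʳ (A * 1ℚ)) (*-identityʳ A)) (bound 0 ≤-refl)

expBound-noWeight : ∀ {S Y} → 0ℚ ≤ Y → ExpBound 0ℚ S Y
expBound-noWeight {S} {Y} 0≤Y m _ = subst (_≤ Y) (sym (trans (cong (_* c) (*-zeroˡ (pow2 m))) (*-zeroˡ c))) 0≤Y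
  where c = 1ℚ + (S - ℕ→ℚ m) ⊓ 1ℚ

expBound-at : ∀ {A S Y} m → 0ℚ ≤ A → ℕ→ℚ m ≤ S → ExpBound A S Y → A * pow2 m ≤ Y
expBound-at {A} {S} {Y} m 0≤A m≤S bound = begin
  A * pow2 m                            ≡⟨ sym (trans (cong (A * pow2 m *_) (+-identityʳ 1ℚ)) (*-identityʳ _)) ⟩
  A * pow2 m * (1ℚ + 0ℚ)                ≤⟨ *-monoˡ-≤-0≤ (A * pow2 m) (0≤* 0≤A (pow2-nonNeg m))
                                             (+-monoʳ-≤ 1ℚ (⊓-glb (p≤q⇒0≤q-p m≤S) 0≤1)) ⟩
  A * pow2 m * (1ℚ + (S - ℕ→ℚ m) ⊓ 1ℚ)  ≤⟨ bound m m≤S ⟩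
  Y                                     ∎

if-yes : ∀ {P A : Set} (d : Dec P) {x y : A} → P → (if ⌊ d ⌋ then x else y) ≡ x
if-yes (yes _) _  = refl
if-yes (no ¬p) p  = ⊥-elim (¬p p)

if-no : ∀ {P A : Set} (d : Dec P) {x y : A} → ¬ P → (if ⌊ d ⌋ then x else y) ≡ y
if-no (yes p) ¬p = ⊥-elim (¬p p)
if-no (no _)  _  = refl

if-0-mono : ∀ (β : Bool) {u v} → u ≤ v → (if β then u else 0ℚ) ≤ (if β then v else 0ℚ)
if-0-mono true  u≤v = u≤v
if-0-mono false _   = ≤-refl

if-0-nonNeg : ∀ (β : Bool) {u} → 0ℚ ≤ u → 0ℚ ≤ (if β then u else 0ℚ)
if-0-nonNeg true  0≤u = 0≤u
if-0-nonNeg false _   = ≤-refl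

if-scale : ∀ (β : Bool) r v → (if β then (1ℚ - r) * v else v) ≡ v - r * (if β then v else 0ℚ)
if-scale true  r v = solve 2 (λ r v → (con 1ℚ :- r) :* v := v :- r :* v) refl r v
if-scale false r v = solve 2 (λ r v → v := v :- r :* con 0ℚ) refl r v

if-scale-≤ : ∀ (β : Bool) {r v} → 0ℚ ≤ r → 0ℚ ≤ v → (if β then (1ℚ - r) * v else v) ≤ v
if-scale-≤ true  {r} {v} 0≤r 0≤v =
  0≤q-p⇒p≤q (subst (0ℚ ≤_) (solve 2 (λ r v → r :* v := v :- (con 1ℚ :- r) :* v) refl r v) (0≤* 0≤r 0≤v))
if-scale-≤ false _ _ = ≤-refl

if-scale-nonNeg : ∀ (β : Bool) {r v} → r ≤ 1ℚ → 0ℚ ≤ v → 0ℚ ≤ (if β then (1ℚ - r) * v else v)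
if-scale-nonNeg true  r≤1 0≤v = 0≤* (p≤q⇒0≤q-p r≤1) 0≤v
if-scale-nonNeg false _   0≤v = 0≤v

if-∧-0 : ∀ (β γ : Bool) (v : ℚ) → (if β ∧ γ then v else 0ℚ) ≡ (if β then (if γ then v else 0ℚ) else 0ℚ)
if-∧-0 true  γ v = refl
if-∧-0 false γ v = refl

if-∧-no : ∀ {P A : Set} (d : Dec P) (γ : Bool) {x y : A} → ¬ P → (if ⌊ d ⌋ ∧ γ then x else y) ≡ y
if-∧-no (yes p) γ ¬p = ⊥-elim (¬p p)
if-∧-no (no _)  γ _  = refl

Σ<-cong : ∀ M {f g} → (∀ j → j ℕ.< M → f j ≡ g j) → Σ< M f ≡ Σ< M g
Σ<-cong zero    _   = refl
Σ<-cong (suc M) f≡g = cong₂ _+_ (Σ<-cong M (λ j j<M → f≡g j (ℕP.m<n⇒m<1+n j<M))) (f≡g M ℕP.≤-refl)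

Σ<-mono : ∀ M {f g} → (∀ j → j ℕ.< M → f j ≤ g j) → Σ< M f ≤ Σ< M g
Σ<-mono zero    _   = ≤-refl
Σ<-mono (suc M) f≤g = +-mono-≤ (Σ<-mono M (λ j j<M → f≤g j (ℕP.m<n⇒m<1+n j<M))) (f≤g M ℕP.≤-refl)

Σ<-nonNeg : ∀ M {f} → (∀ j → j ℕ.< M → 0ℚ ≤ f j) → 0ℚ ≤ Σ< M f
Σ<-nonNeg zero    _   = ≤-refl
Σ<-nonNeg (suc M) 0≤f = 0≤+ (Σ<-nonNeg M (λ j j<M → 0≤f j (ℕP.m<n⇒m<1+n j<M))) (0≤f M ℕP.≤-refl)

Σ<-zero : ∀ M → Σ< M (λ _ → 0ℚ) ≡ 0ℚ
Σ<-zero zero    = refl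
Σ<-zero (suc M) = trans (+-identityʳ _) (Σ<-zero M)

Σ<-linear : ∀ M f g r → Σ< M (λ j → f j - r * g j) ≡ Σ< M f - r * Σ< M g
Σ<-linear zero    f g r = solve 1 (λ r → con 0ℚ := con 0ℚ :- r :* con 0ℚ) refl r
Σ<-linear (suc M) f g r rewrite Σ<-linear M f g r =
  solve 5 (λ F G r a b → F :- r :* G :+ (a :- r :* b) := F :+ a :- r :* (G :+ b)) refl
          (Σ< M f) (Σ< M g) r (f M) (g M)

Σ<-append : ∀ L N f → Σ< (L ℕ.+ N) f ≡ Σ< L f + Σ< N (λ j → f (L ℕ.+ j))
Σ<-append L zero    f rewrite ℕP.+-identityʳ L = sym (+-identityʳ (Σ< L f))
Σ<-append L (suc N) f rewrite ℕP.+-suc L N | Σ<-append L N f =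
  +-assoc (Σ< L f) (Σ< N (λ j → f (L ℕ.+ j))) (f (L ℕ.+ N))

ΣFrom : ℕ → ℕ → (ℕ → ℚ) → ℚ
ΣFrom L M f = Σ< (M ℕ.∸ L) (λ j → f (L ℕ.+ j))

Σ<-split : ∀ {L M} f → L ℕ.≤ M → Σ< M f ≡ Σ< L f + ΣFrom L M f
Σ<-split {L} {M} f L≤M =
  trans (cong (λ N → Σ< N f) (sym (ℕP.m+[n∸m]≡n L≤M))) (Σ<-append L (M ℕ.∸ L) f)

ΣFrom-empty : ∀ M f → ΣFrom M M f ≡ 0ℚ
ΣFrom-empty M f = cong (λ N → Σ< N (λ j → f (M ℕ.+ j))) (ℕP.n∸n≡0 M)

ΣFrom-suc : ∀ {L M} f → L ℕ.≤ M → ΣFrom L (suc M) f ≡ ΣFrom L M f + f M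
ΣFrom-suc {L} {M} f L≤M rewrite ℕP.+-∸-assoc 1 L≤M =
  cong (λ e → ΣFrom L M f + e) (cong f (ℕP.m+[n∸m]≡n L≤M))

ΣFrom-index : ∀ {L M j} → L ℕ.≤ M → j ℕ.< M ℕ.∸ L → L ℕ.+ j ℕ.< M
ΣFrom-index {L} {M} {j} L≤M j<M-L = subst (ℕ._≤ M) (cong suc (ℕP.+-comm j L)) (ℕP.m≤o∸n⇒m+n≤o (suc j) L≤M j<M-L)

ΣFrom-mono : ∀ {L M f g} → L ℕ.≤ M → (∀ j → j ℕ.< M → f j ≤ g j) → ΣFrom L M f ≤ ΣFrom L M g
ΣFrom-mono {L} {M} L≤M f≤g = Σ<-mono (M ℕ.∸ L) (λ j j< → f≤g (L ℕ.+ j) (ΣFrom-index L≤M j<))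

ΣFrom-nonNeg : ∀ {L M f} → L ℕ.≤ M → (∀ j → j ℕ.< M → 0ℚ ≤ f j) → 0ℚ ≤ ΣFrom L M f
ΣFrom-nonNeg {L} {M} L≤M 0≤f = Σ<-nonNeg (M ℕ.∸ L) (λ j j< → 0≤f (L ℕ.+ j) (ΣFrom-index L≤M j<))

Σ<-prefix : ∀ {L M} f → L ℕ.≤ M → Σ< M (λ j → if ⌊ j ℕ.<? L ⌋ then f j else 0ℚ) ≡ Σ< L f
Σ<-prefix {L} {M} f L≤M = begin-equality
  Σ< M g                  ≡⟨ Σ<-split g L≤M ⟩
  Σ< L g + ΣFrom L M g    ≡⟨ cong₂ _+_ (Σ<-cong L (λ j j<L → if-yes (j ℕ.<? L) j<L)) tail≡0 ⟩
  Σ< L f + 0ℚ             ≡⟨ +-identityʳ (Σ< L f) ⟩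
  Σ< L f                  ∎
  where
  g : ℕ → ℚ
  g j = if ⌊ j ℕ.<? L ⌋ then f j else 0ℚ
  tail≡0 : ΣFrom L M g ≡ 0ℚ
  tail≡0 = trans (Σ<-cong (M ℕ.∸ L) (λ j _ → if-no (L ℕ.+ j ℕ.<? L) (ℕP.m+n≮m L j))) (Σ<-zero (M ℕ.∸ L))

minOver-≤ : ∀ {A : Set} (l : List A) f {i} → i ∈ l → minOver l f ≤ f i
minOver-≤ (x ∷ [])    f (here refl) = ≤-refl
minOver-≤ (x ∷ y ∷ l) f (here refl) = p⊓q≤p (f x) (minOver (y ∷ l) f)
minOver-≤ (x ∷ y ∷ l) f (there i∈l) =
  ≤-trans (p⊓q≤q (f x) (minOver (y ∷ l) f)) (minOver-≤ (y ∷ l) f i∈l)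

minOver-nonNeg : ∀ {A : Set} (l : List A) f → (∀ {i} → i ∈ l → 0ℚ ≤ f i) → 0ℚ ≤ minOver l f
minOver-nonNeg []          f _   = ≤-refl
minOver-nonNeg (x ∷ [])    f 0≤f = 0≤f (here refl)
minOver-nonNeg (x ∷ y ∷ l) f 0≤f = ⊓-glb (0≤f (here refl)) (minOver-nonNeg (y ∷ l) f (λ i∈ → 0≤f (there i∈)))

sumℚ-nonNeg : ∀ {A : Set} (l : List A) (f : A → ℚ) → (∀ i → 0ℚ ≤ f i) → 0ℚ ≤ sumℚ (map f l)
sumℚ-nonNeg []      f _   = ≤-refl
sumℚ-nonNeg (x ∷ l) f 0≤f = 0≤+ (0≤f x) (sumℚ-nonNeg l f 0≤f)

sumℚ-≥-term : ∀ {A : Set} (l : List A) (f : A → ℚ) → (∀ i → 0ℚ ≤ f i) → ∀ {i} → i ∈ l → f i ≤ sumℚ (map f l)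
sumℚ-≥-term (x ∷ l) f 0≤f (here refl) = begin
  f x                   ≡⟨ sym (+-identityʳ (f x)) ⟩
  f x + 0ℚ              ≤⟨ +-monoʳ-≤ (f x) (sumℚ-nonNeg l f 0≤f) ⟩
  f x + sumℚ (map f l)  ∎
sumℚ-≥-term (x ∷ l) f 0≤f {i} (there i∈l) = begin
  f i                   ≤⟨ sumℚ-≥-term l f 0≤f i∈l ⟩
  sumℚ (map f l)        ≡⟨ sym (+-identityˡ _) ⟩
  0ℚ + sumℚ (map f l)   ≤⟨ +-monoˡ-≤ _ (0≤f x) ⟩
  f x + sumℚ (map f l)  ∎

-- The ceiling logarithm: 2^⌈log₂ n⌉ ≥ n, by the recursion n ↦ 1 + ⌈(n-2)/2⌉.
n≤2^⌈log₂n⌉ : ∀ n → n ℕ.≤ 2 ℕ.^ ⌈log₂ n ⌉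
n≤2^⌈log₂n⌉ n = bound n
  where
  halving : ∀ m → suc (suc m) ℕ.≤ 2 ℕ.* suc ℕ.⌈ m /2⌉
  halving m = ℕP.≤-trans
    (s≤s (s≤s (subst (ℕ._≤ h ℕ.+ h) (ℕP.⌊n/2⌋+⌈n/2⌉≡n m) (ℕP.+-monoˡ-≤ h (ℕP.⌊n/2⌋≤⌈n/2⌉ m)))))
    (ℕP.≤-reflexive (cong suc (trans (cong (λ e → suc (h ℕ.+ e)) (sym (ℕP.+-identityʳ h))) (sym (ℕP.+-suc h (h ℕ.+ 0))))))
    where h = ℕ.⌈ m /2⌉
  bound : ∀ m {ac} → m ℕ.≤ 2 ℕ.^ ⌈log2⌉ m ac
  bound zero                   = z≤n
  bound (suc zero)             = s≤s z≤n
  bound (suc (suc m)) {acc rs} = ℕP.≤-trans (halving m) (ℕP.*-monoʳ-≤ 2 (bound (suc ℕ.⌈ m /2⌉)))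

module Analysis (n : ℕ) (c : Fin n → ℚ) (a : ℕ → Fin n → ℚ)
                (c-pos : ∀ i → 0ℚ < c i) (a-nonNeg : ∀ j i → 0ℚ ≤ a j i) where

  open AlgorithmI n c a

  2≤maxT : ∀ h → 2 ℕ.≤ maxT h
  2≤maxT zero    = ℕP.m≤m⊔n 2 (length (T zero))
  2≤maxT (suc h) = ℕP.≤-trans (2≤maxT h) (ℕP.m≤m⊔n (maxT h) (length (T (suc h))))

  |T|≤maxT : ∀ h → length (T h) ℕ.≤ maxT h
  |T|≤maxT zero    = ℕP.m≤n⊔m 2 (length (T zero))
  |T|≤maxT (suc h) = ℕP.m≤n⊔m (maxT h) (length (T (suc h)))

  1≤logk : ∀ h → 1 ℕ.≤ logk h
  1≤logk h = ⌈log₂⌉-mono-≤ (2≤maxT h)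

  K : ℕ → ℚ
  K h = ℕ→ℚ (k h)

  K-pos : ∀ h → 0ℚ < K h
  K-pos h = <-≤-trans 0<1 (ℕ→ℚ-mono {1} {k h} (ℕP.m^n>0 2 (logk h)))

  K-mono : ∀ h → K h ≤ K (suc h)
  K-mono h = ℕ→ℚ-mono (ℕP.^-monoʳ-≤ 2 (⌈log₂⌉-mono-≤ (ℕP.m≤m⊔n (maxT h) (length (T (suc h))))))

  |T|≤K : ∀ h → ℕ→ℚ (length (T h)) ≤ K h
  |T|≤K h = ℕ→ℚ-mono (ℕP.≤-trans (|T|≤maxT h) (n≤2^⌈log₂n⌉ (maxT h)))

  -- 5 log k ≥ 2 log k + 1, the exponent needed in weight-bound
  1+2logk≤5logk : ∀ h → suc (logk h ℕ.+ logk h) ℕ.≤ 5 ℕ.* logk h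
  1+2logk≤5logk h = ℕP.≤-trans (ℕP.≤-reflexive (sym (ℕP.+-suc l l)))
    (ℕP.+-monoʳ-≤ l (ℕP.≤-trans (ℕP.+-monoˡ-≤ l (1≤logk h)) (ℕP.+-monoʳ-≤ l (ℕP.m≤m+n l (l ℕ.+ (l ℕ.+ 0))))))
    where l = logk h

  T-pos : ∀ {h i} → i ∈ T h → 0ℚ < a h i
  T-pos {h} i∈T = proj₂ (∈-filter⁻ (λ i → 0ℚ <? a h i) {xs = allFin n} i∈T)

  T-intro : ∀ {h i} → 0ℚ < a h i → i ∈ T h
  T-intro {h} {i} 0<a = ∈-filter⁺ (λ i → 0ℚ <? a h i) (∈-allFin i) 0<a

  a≡0 : ∀ {h i} → ¬ (0ℚ < a h i) → a h i ≡ 0ℚ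
  a≡0 {h} {i} a≯0 = ≤-antisym (≮⇒≥ a≯0) (a-nonNeg h i)

  d-pos : ∀ {h i} → 0ℚ < a h i → 0ℚ < d h i
  d-pos {h} {i} 0<a = 0<* (c-pos i) (inv-pos 0<a)

  dm-nonNeg : ∀ h → 0ℚ ≤ dm h
  dm-nonNeg h = minOver-nonNeg (T h) (d h) (λ i∈T → <⇒≤ (d-pos (T-pos i∈T)))

  dm≤d : ∀ {h i} → 0ℚ < a h i → dm h ≤ d h i
  dm≤d {h} 0<a = minOver-≤ (T h) (d h) (T-intro 0<a)

  term≤cover : ∀ h x → (∀ i → 0ℚ ≤ x i) → ∀ i → a h i * x i ≤ cover h x
  term≤cover h x 0≤x i =
    sumℚ-≥-term (allFin n) (λ i → a h i * x i) (λ i → 0≤* (a-nonNeg h i) (0≤x i)) (∈-allFin i)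

  ρ : ℕ → Fin n → ℚ
  ρ h i = dm h * inv (d h i)

  module _ {h : ℕ} {i : Fin n} (0<a : 0ℚ < a h i) where

    ρ-nonNeg : 0ℚ ≤ ρ h i
    ρ-nonNeg = 0≤* (dm-nonNeg h) (<⇒≤ (inv-pos (d-pos 0<a)))

    ρ≤1 : ρ h i ≤ 1ℚ
    ρ≤1 = ≤-trans (*-monoʳ-≤-0≤ (inv (d h i)) (<⇒≤ (inv-pos (d-pos 0<a))) (dm≤d 0<a))
                  (≤-reflexive (trans (*-comm (d h i) (inv (d h i))) (inv-inverseˡ (d-pos 0<a))))

    ρ*c : ρ h i * c i ≡ dm h * a h i
    ρ*c = trans (*-assoc (dm h) (inv (d h i)) (c i)) (cong (dm h *_) inv[d]*c)
      where
      inv[d]*c : inv (d h i) * c i ≡ a h i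
      inv[d]*c = begin-equality
        inv (d h i) * c i                          ≡⟨ sym (*-identityʳ _) ⟩
        inv (d h i) * c i * 1ℚ                     ≡⟨ cong (inv (d h i) * c i *_) (sym (inv-inverseˡ 0<a)) ⟩
        inv (d h i) * c i * (inv (a h i) * a h i)  ≡⟨ solve 4 (λ x y z w → x :* y :* (z :* w) := x :* (y :* z) :* w)
                                                             refl (inv (d h i)) (c i) (inv (a h i)) (a h i) ⟩
        inv (d h i) * d h i * a h i                ≡⟨ cong (_* a h i) (inv-inverseˡ (d-pos 0<a)) ⟩
        1ℚ * a h i                                 ≡⟨ *-identityˡ (a h i) ⟩
        a h i                                      ∎

    K*c*increment : K h * c i * (inv (K h * a h i) * ρ h i) ≡ dm h
    K*c*increment = begin-equality
      K h * c i * (e * ρ h i)      ≡⟨ solve 4 (λ k c e r → k :* c :* (e :* r) := e :* k :* (r :* c)) refl (K h) (c i) e (ρ h i) ⟩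
      e * K h * (ρ h i * c i)      ≡⟨ cong (e * K h *_) ρ*c ⟩
      e * K h * (dm h * a h i)     ≡⟨ solve 4 (λ e k m a → e :* k :* (m :* a) := m :* (e :* (k :* a))) refl e (K h) (dm h) (a h i) ⟩
      dm h * (e * (K h * a h i))   ≡⟨ cong (dm h *_) (inv-inverseˡ (0<* (K-pos h) 0<a)) ⟩
      dm h * 1ℚ                    ≡⟨ *-identityʳ (dm h) ⟩
      dm h                         ∎
      where e = inv (K h * a h i)

  φ : ℕ → Fin n → ℚ → ℚ
  φ h i X = if ⌊ 0ℚ <? a h i ⌋ then (1ℚ + ρ h i) * X + inv (K h * a h i) * ρ h i else X

  iter-primalStep : ∀ h t x i → iter t (primalStep h) x i ≡ iter t (φ h i) (x i)
  iter-primalStep h zero    x i = refl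
  iter-primalStep h (suc t) x i = cong (φ h i) (iter-primalStep h t x i)

  φ-active : ∀ {h i} → 0ℚ < a h i → ∀ X → φ h i X ≡ (1ℚ + ρ h i) * X + inv (K h * a h i) * ρ h i
  φ-active {h} {i} 0<a X = if-yes (0ℚ <? a h i) 0<a

  φ-inactive : ∀ {h i} → ¬ (0ℚ < a h i) → ∀ t X → iter t (φ h i) X ≡ X
  φ-inactive a≯0 zero    X = refl
  φ-inactive {h} {i} a≯0 (suc t) X = trans (if-no (0ℚ <? a h i) a≯0) (φ-inactive a≯0 t X)

  K*c*φ : ∀ {h i} → 0ℚ < a h i → ∀ X → K h * c i * φ h i X ≡ (1ℚ + ρ h i) * (K h * c i * X) + dm h
  K*c*φ {h} {i} 0<a X = begin-equality
    K h * c i * φ h i X                              ≡⟨ cong (K h * c i *_) (φ-active 0<a X) ⟩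
    K h * c i * ((1ℚ + ρ h i) * X + e)               ≡⟨ solve 5 (λ k c r x e → k :* c :* ((con 1ℚ :+ r) :* x :+ e)
                                                          := (con 1ℚ :+ r) :* (k :* c :* x) :+ k :* c :* e) refl (K h) (c i) (ρ h i) X e ⟩
    (1ℚ + ρ h i) * (K h * c i * X) + K h * c i * e   ≡⟨ cong ((1ℚ + ρ h i) * (K h * c i * X) +_) (K*c*increment 0<a) ⟩
    (1ℚ + ρ h i) * (K h * c i * X) + dm h            ∎
    where e = inv (K h * a h i) * ρ h i

  φ-nonNeg : ∀ h i t {X} → 0ℚ ≤ X → 0ℚ ≤ iter t (φ h i) X
  φ-nonNeg h i zero    0≤X = 0≤X
  φ-nonNeg h i (suc t) {X} 0≤X = step (0ℚ <? a h i)
    where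
    step : Dec (0ℚ < a h i) → 0ℚ ≤ φ h i (iter t (φ h i) X)
    step (yes 0<a) = subst (0ℚ ≤_) (sym (φ-active 0<a _))
                       (0≤+ (0≤* (0≤+ 0≤1 (ρ-nonNeg 0<a)) (φ-nonNeg h i t 0≤X))
                            (0≤* (<⇒≤ (inv-pos (0<* (K-pos h) 0<a))) (ρ-nonNeg 0<a)))
    step (no a≯0)  = subst (0ℚ ≤_) (sym (φ-inactive a≯0 1 _)) (φ-nonNeg h i t 0≤X)

  K*c-nonNeg : ∀ h i {X} → 0ℚ ≤ X → 0ℚ ≤ K h * c i * X
  K*c-nonNeg h i 0≤X = 0≤* (0≤* (<⇒≤ (K-pos h)) (<⇒≤ (c-pos i))) 0≤X

  iter-gain : ∀ {h i} → 0ℚ < a h i → ∀ t {X} → 0ℚ ≤ X →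
              K h * c i * X + dm h * ℕ→ℚ t ≤ K h * c i * iter t (φ h i) X
  iter-gain {h} {i} 0<a zero {X} _ = ≤-reflexive (trans (cong (K h * c i * X +_) (*-zeroʳ (dm h))) (+-identityʳ _))
  iter-gain {h} {i} 0<a (suc t) {X} 0≤X = begin
    Y₀ + dm h * ℕ→ℚ (suc t)          ≡⟨ cong (λ e → Y₀ + dm h * e) (ℕ→ℚ-suc t) ⟩
    Y₀ + dm h * (1ℚ + ℕ→ℚ t)         ≡⟨ solve 3 (λ Y m T → Y :+ m :* (con 1ℚ :+ T) := Y :+ m :* T :+ m) refl Y₀ (dm h) (ℕ→ℚ t) ⟩
    Y₀ + dm h * ℕ→ℚ t + dm h         ≤⟨ +-monoˡ-≤ (dm h) (iter-gain 0<a t 0≤X) ⟩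
    Y + dm h                         ≤⟨ +-monoˡ-≤ (dm h) Y≤[1+ρ]Y ⟩
    (1ℚ + ρ h i) * Y + dm h          ≡⟨ sym (K*c*φ 0<a (iter t (φ h i) X)) ⟩
    K h * c i * iter (suc t) (φ h i) X ∎
    where
    Y₀ = K h * c i * X
    Y = K h * c i * iter t (φ h i) X
    Y≤[1+ρ]Y : Y ≤ (1ℚ + ρ h i) * Y
    Y≤[1+ρ]Y = 0≤q-p⇒p≤q (subst (0ℚ ≤_) (solve 2 (λ r Y → r :* Y := (con 1ℚ :+ r) :* Y :- Y) refl (ρ h i) Y)
                                       (0≤* (ρ-nonNeg 0<a) (K*c-nonNeg h i (φ-nonNeg h i t 0≤X))))

  iter-expBound : ∀ {h i} → 0ℚ < a h i → ∀ t {A S X} → 0ℚ ≤ A → 0ℚ ≤ S → 0ℚ ≤ X →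
                  ExpBound A S (K h * c i * X) → ExpBound A (S + ρ h i * ℕ→ℚ t) (K h * c i * iter t (φ h i) X)
  iter-expBound {h} {i} 0<a zero {A} {S} {X} _ _ _ bound =
    subst (λ e → ExpBound A e (K h * c i * X)) (sym (trans (cong (S +_) (*-zeroʳ (ρ h i))) (+-identityʳ S))) bound
  iter-expBound {h} {i} 0<a (suc t) {A} {S} {X} 0≤A 0≤S 0≤X bound =
    subst (λ e → ExpBound A e (K h * c i * iter (suc t) (φ h i) X)) exponent
      (expBound-raise {A} Y′≤K*c*φ
        (expBound-step 0≤A (0≤+ 0≤S (0≤* (ρ-nonNeg 0<a) (ℕ→ℚ-nonNeg t))) (ρ-nonNeg 0<a) (ρ≤1 0<a)
          (iter-expBound 0<a t 0≤A 0≤S 0≤X bound)))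
    where
    Y′ = (1ℚ + ρ h i) * (K h * c i * iter t (φ h i) X)
    Y′≤K*c*φ : Y′ ≤ K h * c i * iter (suc t) (φ h i) X
    Y′≤K*c*φ = begin
      Y′          ≡⟨ sym (+-identityʳ Y′) ⟩
      Y′ + 0ℚ     ≤⟨ +-monoʳ-≤ Y′ (dm-nonNeg h) ⟩
      Y′ + dm h   ≡⟨ sym (K*c*φ 0<a (iter t (φ h i) X)) ⟩
      K h * c i * iter (suc t) (φ h i) X ∎
    exponent : S + ρ h i * ℕ→ℚ t + ρ h i ≡ S + ρ h i * ℕ→ℚ (suc t)
    exponent = trans (solve 3 (λ S r T → S :+ r :* T :+ r := S :+ r :* (con 1ℚ :+ T)) refl S (ρ h i) (ℕ→ℚ t))
                     (cong (λ e → S + ρ h i * e) (sym (ℕ→ℚ-suc t)))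

  -- For a dual vector y, a variable i and a cut L:
  --   weight y L i = Σ_{j<L, i∈T_j} y_j     (dual weight of i before the cut)
  --   load h L y i = Σ_{L≤j<h} a_{ij} y_j / c_i   (load of i after the cut)
  -- and the invariant says  k c_i x_i ≥ weight · 2^load  (in the sense of
  -- ExpBound): every unit of load after the cut has doubled x_i.

  onVar : Fin n → (ℕ → ℚ) → ℕ → ℚ
  onVar i y j = if ⌊ 0ℚ <? a j i ⌋ then y j else 0ℚ

  weight : (ℕ → ℚ) → ℕ → Fin n → ℚ
  weight y L i = Σ< L (onVar i y)

  load : ℕ → ℕ → (ℕ → ℚ) → Fin n → ℚ
  load h L y i = ΣFrom L h (λ j → a j i * y j) * inv (c i)

  Potential : ℕ → Fin n → ℕ → ℚ → (ℕ → ℚ) → Set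
  Potential h i L X y = ExpBound (weight y L i) (load h L y i) (K h * c i * X)

  load-empty : ∀ h y i → load h h y i ≡ 0ℚ
  load-empty h y i = trans (cong (_* inv (c i)) (ΣFrom-empty h (λ j → a j i * y j))) (*-zeroˡ (inv (c i)))

  potential-antitone : ∀ {h i L X y z} → L ℕ.≤ h → (∀ j → 0ℚ ≤ z j) → (∀ j → j ℕ.< h → z j ≤ y j) →
                       Potential h i L X y → Potential h i L X z
  potential-antitone {h} {i} {L} {X} {y} {z} L≤h 0≤z z≤y =
    expBound-weaken (Σ<-nonNeg L (λ j _ → if-0-nonNeg ⌊ 0ℚ <? a j i ⌋ (0≤z j)))
                    (Σ<-mono L (λ j j<L → if-0-mono ⌊ 0ℚ <? a j i ⌋ (z≤y j (ℕP.<-≤-trans j<L L≤h))))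
                    (*-monoʳ-≤-0≤ (inv (c i)) (<⇒≤ (inv-pos (c-pos i)))
                       (ΣFrom-mono L≤h (λ j j<h → *-monoˡ-≤-0≤ (a j i) (a-nonNeg j i) (z≤y j j<h))))

  record Invariant (h : ℕ) (x : Fin n → ℚ) (y : ℕ → ℚ) : Set where
    field
      x-nonNeg  : ∀ i → 0ℚ ≤ x i
      y-nonNeg  : ∀ j → 0ℚ ≤ y j
      y-unseen  : ∀ j → h ℕ.≤ j → y j ≡ 0ℚ
      potential : ∀ i L → L ℕ.≤ h → Potential h i L (x i) y

  invariant-start : Invariant zero (λ _ → 0ℚ) (λ _ → 0ℚ)
  invariant-start = record
    { x-nonNeg  = λ _ → ≤-refl
    ; y-nonNeg  = λ _ → ≤-refl
    ; y-unseen  = λ _ _ → refl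
    ; potential = λ { i zero _ → expBound-noWeight (K*c-nonNeg zero i ≤-refl) }
    }

  raise : (ℕ → ℚ) → ℕ → ℕ → (ℕ → ℚ)
  raise y h t = setAt y h (dm h * ℕ→ℚ t)

  raise-≢ : ∀ y h t {j} → j ≢ h → raise y h t j ≡ y j
  raise-≢ y h t {j} j≢h = if-no (j ℕ.≟ h) j≢h

  raise-≡ : ∀ y h t → raise y h t h ≡ dm h * ℕ→ℚ t
  raise-≡ y h t = if-yes (h ℕ.≟ h) refl

  raise-below : ∀ y h t {j} → j ℕ.< h → raise y h t j ≡ y j
  raise-below y h t j<h = raise-≢ y h t (ℕP.<⇒≢ j<h)

  newWeight : ℕ → Fin n → ℕ → ℚ
  newWeight h i t = if ⌊ 0ℚ <? a h i ⌋ then dm h * ℕ→ℚ t else 0ℚ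

  primal-gain : ∀ {h i} t {X} → 0ℚ ≤ X → K h * c i * X + newWeight h i t ≤ K h * c i * iter t (φ h i) X
  primal-gain {h} {i} t {X} 0≤X = byCase (0ℚ <? a h i)
    where
    byCase : Dec (0ℚ < a h i) → K h * c i * X + newWeight h i t ≤ K h * c i * iter t (φ h i) X
    byCase (yes 0<a) = subst (λ e → K h * c i * X + e ≤ K h * c i * iter t (φ h i) X) (sym (if-yes (0ℚ <? a h i) 0<a)) (iter-gain 0<a t 0≤X)
    byCase (no a≯0)  = ≤-reflexive (begin-equality
      K h * c i * X + newWeight h i t    ≡⟨ cong (K h * c i * X +_) (if-no (0ℚ <? a h i) a≯0) ⟩
      K h * c i * X + 0ℚ                 ≡⟨ +-identityʳ _ ⟩
      K h * c i * X                      ≡⟨ cong (K h * c i *_) (sym (φ-inactive a≯0 t X)) ⟩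
      K h * c i * iter t (φ h i) X       ∎)

  primal-growth : ∀ {h i} t {A S X} → 0ℚ ≤ A → 0ℚ ≤ S → 0ℚ ≤ X → ExpBound A S (K h * c i * X) →
                  ExpBound A (S + a h i * (dm h * ℕ→ℚ t) * inv (c i)) (K h * c i * iter t (φ h i) X)
  primal-growth {h} {i} t {A} {S} {X} 0≤A 0≤S 0≤X bound = byCase (0ℚ <? a h i)
    where
    Goal : Set
    Goal = ExpBound A (S + a h i * (dm h * ℕ→ℚ t) * inv (c i)) (K h * c i * iter t (φ h i) X)
    newLoad : 0ℚ < a h i → a h i * (dm h * ℕ→ℚ t) * inv (c i) ≡ ρ h i * ℕ→ℚ t
    newLoad 0<a = begin-equality
      a h i * (dm h * ℕ→ℚ t) * inv (c i)      ≡⟨ solve 4 (λ A m T ic → A :* (m :* T) :* ic := (m :* A) :* (T :* ic)) refl (a h i) (dm h) (ℕ→ℚ t) (inv (c i)) ⟩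
      dm h * a h i * (ℕ→ℚ t * inv (c i))      ≡⟨ cong (_* (ℕ→ℚ t * inv (c i))) (sym (ρ*c 0<a)) ⟩
      ρ h i * c i * (ℕ→ℚ t * inv (c i))       ≡⟨ solve 4 (λ r C T ic → r :* C :* (T :* ic) := r :* T :* (ic :* C)) refl (ρ h i) (c i) (ℕ→ℚ t) (inv (c i)) ⟩
      ρ h i * ℕ→ℚ t * (inv (c i) * c i)       ≡⟨ cong (ρ h i * ℕ→ℚ t *_) (inv-inverseˡ (c-pos i)) ⟩
      ρ h i * ℕ→ℚ t * 1ℚ                      ≡⟨ *-identityʳ _ ⟩
      ρ h i * ℕ→ℚ t                           ∎
    noLoad : ¬ (0ℚ < a h i) → S + a h i * (dm h * ℕ→ℚ t) * inv (c i) ≡ S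
    noLoad a≯0 = trans (cong (λ e → S + e * (dm h * ℕ→ℚ t) * inv (c i)) (a≡0 a≯0))
                   (trans (cong (λ e → S + e * inv (c i)) (*-zeroˡ (dm h * ℕ→ℚ t)))
                          (trans (cong (S +_) (*-zeroˡ (inv (c i)))) (+-identityʳ S)))
    byCase : Dec (0ℚ < a h i) → Goal
    byCase (yes 0<a) = subst (λ e → ExpBound A (S + e) (K h * c i * iter t (φ h i) X)) (sym (newLoad 0<a)) (iter-expBound 0<a t 0≤A 0≤S 0≤X bound)
    byCase (no a≯0)  = subst₂ (λ e X′ → ExpBound A e (K h * c i * X′)) (sym (noLoad a≯0)) (sym (φ-inactive a≯0 t X)) bound

  potential-old : ∀ {h x y} → Invariant h x y → ∀ t i L → L ℕ.≤ h →
                  Potential (suc h) i L (iter t (φ h i) (x i)) (raise y h t)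
  potential-old {h} {x} {y} I t i L L≤h =
    subst₂ (λ W S → ExpBound W S (K (suc h) * c i * iter t (φ h i) (x i))) (sym weight≡) (sym load≡)
      (expBound-raise {weight y L i} (*-monoʳ-≤-0≤ _ (φ-nonNeg h i t (x-nonNeg i)) (*-monoʳ-≤-0≤ (c i) (<⇒≤ (c-pos i)) (K-mono h)))
        (primal-growth {h} {i} t (Σ<-nonNeg L (λ j _ → if-0-nonNeg ⌊ 0ℚ <? a j i ⌋ (y-nonNeg j))) (load-nonNeg) (x-nonNeg i) (potential i L L≤h)))
    where
    open Invariant I
    load-nonNeg : 0ℚ ≤ load h L y i
    load-nonNeg = 0≤* (ΣFrom-nonNeg L≤h (λ j _ → 0≤* (a-nonNeg j i) (y-nonNeg j))) (<⇒≤ (inv-pos (c-pos i)))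
    weight≡ : weight (raise y h t) L i ≡ weight y L i
    weight≡ = Σ<-cong L (λ j j<L → cong (λ e → if ⌊ 0ℚ <? a j i ⌋ then e else 0ℚ)
                                         (raise-below y h t (ℕP.<-≤-trans j<L L≤h)))
    load≡ : load (suc h) L (raise y h t) i ≡ load h L y i + a h i * (dm h * ℕ→ℚ t) * inv (c i)
    load≡ = trans (cong (_* inv (c i)) (trans (ΣFrom-suc (λ j → a j i * raise y h t j) L≤h)
                    (cong₂ _+_ (Σ<-cong (h ℕ.∸ L) (λ j j< → cong (a (L ℕ.+ j) i *_) (raise-below y h t (ΣFrom-index L≤h j<))))
                               (cong (a h i *_) (raise-≡ y h t)))))
                  (*-distribʳ-+ (inv (c i)) (ΣFrom L h (λ j → a j i * y j)) (a h i * (dm h * ℕ→ℚ t)))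

  potential-new : ∀ {h x y} → Invariant h x y → ∀ t i →
                  Potential (suc h) i (suc h) (iter t (φ h i) (x i)) (raise y h t)
  potential-new {h} {x} {y} I t i =
    subst (λ S → ExpBound (weight y′ (suc h) i) S (K (suc h) * c i * X′)) (sym (load-empty (suc h) y′ i))
      (expBound-zero (begin
        weight y′ h i + onVar i y′ h              ≡⟨ cong₂ _+_ oldWeight≡ newWeight≡ ⟩
        weight y h i + newWeight h i t            ≤⟨ +-monoˡ-≤ (newWeight h i t) oldWeight≤ ⟩
        K h * c i * x i + newWeight h i t         ≤⟨ primal-gain {h} {i} t (x-nonNeg i) ⟩
        K h * c i * X′                            ≤⟨ *-monoʳ-≤-0≤ X′ (φ-nonNeg h i t (x-nonNeg i))
                                                      (*-monoʳ-≤-0≤ (c i) (<⇒≤ (c-pos i)) (K-mono h)) ⟩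
        K (suc h) * c i * X′                      ∎))
    where
    open Invariant I
    X′ = iter t (φ h i) (x i)
    y′ = raise y h t
    oldWeight≡ : weight y′ h i ≡ weight y h i
    oldWeight≡ = Σ<-cong h (λ j j<h → cong (λ e → if ⌊ 0ℚ <? a j i ⌋ then e else 0ℚ) (raise-below y h t j<h))
    newWeight≡ : onVar i y′ h ≡ newWeight h i t
    newWeight≡ = cong (λ e → if ⌊ 0ℚ <? a h i ⌋ then e else 0ℚ) (raise-≡ y h t)
    oldWeight≤ : weight y h i ≤ K h * c i * x i
    oldWeight≤ = expBound-zero⁻¹ (subst (λ S → ExpBound (weight y h i) S (K h * c i * x i)) (load-empty h y i)
                                         (potential i h ℕP.≤-refl))

  potential-next : ∀ {h x y} → Invariant h x y → ∀ t i L → L ℕ.≤ suc h →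
                   Potential (suc h) i L (iter t (primalStep h) x i) (raise y h t)
  potential-next {h} {x} {y} I t i L L≤h+1 =
    subst (λ X → Potential (suc h) i L X (raise y h t)) (sym (iter-primalStep h t x i))
          (byCut (ℕP.m≤n⇒m<n∨m≡n L≤h+1))
    where
    byCut : L ℕ.< suc h ⊎ L ≡ suc h → Potential (suc h) i L (iter t (φ h i) (x i)) (raise y h t)
    byCut (inj₁ L<h+1)  = potential-old I t i L (ℕP.≤-pred L<h+1)
    byCut (inj₂ L≡h+1) = subst (λ L → Potential (suc h) i L (iter t (φ h i) (x i)) (raise y h t))
                               (sym L≡h+1) (potential-new I t i)

  -- Step (b) of the dual update only lowers dual values below h.  Dominated h w z
  -- says that z ≥ 0 arises from w in this way.
  record Dominated (h : ℕ) (w z : ℕ → ℚ) : Set where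
    field
      nonNeg : ∀ j → 0ℚ ≤ z j
      below  : ∀ j → j ℕ.< h → z j ≤ w j
      above  : ∀ j → h ℕ.≤ j → z j ≡ w j

  threshold halfThreshold : ℕ → Fin n → ℚ
  threshold     h i = ℕ→ℚ (10 ℕ.* logk h) * c i
  halfThreshold h i = ℕ→ℚ (5 ℕ.* logk h) * c i

  cut : ℕ → Fin n → (ℕ → ℚ) → ℕ
  cut h i z = largestPrefix i z (halfThreshold h i) h

  shrink : ℕ → Fin n → (ℕ → ℚ) → (ℕ → ℚ)
  shrink h i z j = if ⌊ j ℕ.<? cut h i z ⌋ ∧ ⌊ 0ℚ <? a j i ⌋ then (1ℚ - ρ h i) * z j else z j

  dualStep-quiet : ∀ h z i → Σ< h (λ j → a j i * z j) ≤ threshold h i → dualStepI h z i ≡ z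
  dualStep-quiet h z i quiet = if-yes (Σ< h (λ j → a j i * z j) ≤? threshold h i) quiet

  dualStep-fires : ∀ h z i → ¬ (Σ< h (λ j → a j i * z j) ≤ threshold h i) → dualStepI h z i ≡ shrink h i z
  dualStep-fires h z i fires = if-no (Σ< h (λ j → a j i * z j) ≤? threshold h i) fires

  largestPrefix-≤ : ∀ i z b m → largestPrefix i z b m ℕ.≤ m
  largestPrefix-≤ i z b zero = z≤n
  largestPrefix-≤ i z b (suc m) with Σ< (suc m) (λ j → a j i * z j) ≤? b
  ... | yes _ = ℕP.≤-refl
  ... | no _  = ℕP.m≤n⇒m≤1+n (largestPrefix-≤ i z b m)

  largestPrefix-load : ∀ i z b m → 0ℚ ≤ b → Σ< (largestPrefix i z b m) (λ j → a j i * z j) ≤ b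
  largestPrefix-load i z b zero    0≤b = 0≤b
  largestPrefix-load i z b (suc m) 0≤b with Σ< (suc m) (λ j → a j i * z j) ≤? b
  ... | yes within = within
  ... | no _       = largestPrefix-load i z b m 0≤b

  cut≤h : ∀ h i z → cut h i z ℕ.≤ h
  cut≤h h i z = largestPrefix-≤ i z (halfThreshold h i) h

  shrink-loss : ∀ h i z → Σ< (suc h) z - Σ< (suc h) (shrink h i z) ≡ ρ h i * weight z (cut h i z) i
  shrink-loss h i z = begin-equality
    Σ< (suc h) z - Σ< (suc h) (shrink h i z)                                ≡⟨ cong (λ e → Σ< (suc h) z - e) shrunk ⟩
    Σ< (suc h) z - (Σ< (suc h) z - ρ h i * weight z L i)                    ≡⟨ solve 2 (λ S q → S :- (S :- q) := q) refl
                                                                                 (Σ< (suc h) z) (ρ h i * weight z L i) ⟩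
    ρ h i * weight z L i                                                    ∎
    where
    L = cut h i z
    selected : ℕ → ℚ
    selected j = if ⌊ j ℕ.<? L ⌋ ∧ ⌊ 0ℚ <? a j i ⌋ then z j else 0ℚ
    selected-sum : Σ< (suc h) selected ≡ weight z L i
    selected-sum = trans (Σ<-cong (suc h) (λ j _ → if-∧-0 ⌊ j ℕ.<? L ⌋ ⌊ 0ℚ <? a j i ⌋ (z j)))
                         (Σ<-prefix (onVar i z) (ℕP.m≤n⇒m≤1+n (cut≤h h i z)))
    shrunk : Σ< (suc h) (shrink h i z) ≡ Σ< (suc h) z - ρ h i * weight z L i
    shrunk = trans (Σ<-cong (suc h) (λ j _ → if-scale (⌊ j ℕ.<? L ⌋ ∧ ⌊ 0ℚ <? a j i ⌋) (ρ h i) (z j)))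
                   (trans (Σ<-linear (suc h) z selected (ρ h i)) (cong (λ e → Σ< (suc h) z - ρ h i * e) selected-sum))

  shrink-dominated : ∀ {h i w z} → 0ℚ < a h i → Dominated h w z → Dominated h w (shrink h i z)
  shrink-dominated {h} {i} {w} {z} 0<a dom = record
    { nonNeg = λ j → if-scale-nonNeg (β j) (ρ≤1 0<a) (nonNeg j)
    ; below  = λ j j<h → ≤-trans (if-scale-≤ (β j) (ρ-nonNeg 0<a) (nonNeg j)) (below j j<h)
    ; above  = λ j h≤j → trans (if-∧-no (j ℕ.<? cut h i z) ⌊ 0ℚ <? a j i ⌋ (λ j<cut →
                            ℕP.<-irrefl refl (ℕP.<-≤-trans j<cut (ℕP.≤-trans (cut≤h h i z) h≤j)))) (above j h≤j)
    }
    where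
    open Dominated dom
    β : ℕ → Bool
    β j = ⌊ j ℕ.<? cut h i z ⌋ ∧ ⌊ 0ℚ <? a j i ⌋

  dualStep-dominated : ∀ {h i w z} → 0ℚ < a h i → Dominated h w z → Dominated h w (dualStepI h z i)
  dualStep-dominated {h} {i} {w} {z} 0<a dom = byCase (Σ< h (λ j → a j i * z j) ≤? threshold h i)
    where
    byCase : Dec (Σ< h (λ j → a j i * z j) ≤ threshold h i) → Dominated h w (dualStepI h z i)
    byCase (yes quiet) = subst (Dominated h w) (sym (dualStep-quiet h z i quiet)) dom
    byCase (no fires)  = subst (Dominated h w) (sym (dualStep-fires h z i fires)) (shrink-dominated 0<a dom)

  -- When step (b)(ii) fires for i, the load after the cut is at least 5 log k,
  -- because the load before the cut is at most 5 log k of the total > 10 log k.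
  cut-load : ∀ {h i z} → ¬ (Σ< h (λ j → a j i * z j) ≤ threshold h i) →
             ℕ→ℚ (5 ℕ.* logk h) ≤ load h (cut h i z) z i
  cut-load {h} {i} {z} fires = begin
    ℕ→ℚ (5 ℕ.* l)                        ≡⟨ sym (trans (*-assoc (ℕ→ℚ (5 ℕ.* l)) (c i) (inv (c i)))
                                               (trans (cong (ℕ→ℚ (5 ℕ.* l) *_) (trans (*-comm (c i) (inv (c i))) (inv-inverseˡ (c-pos i))))
                                                      (*-identityʳ (ℕ→ℚ (5 ℕ.* l))))) ⟩
    B * inv (c i)                        ≤⟨ *-monoʳ-≤-0≤ (inv (c i)) (<⇒≤ (inv-pos (c-pos i))) B≤tail ⟩
    ΣFrom L h F * inv (c i)              ∎
    where
    l = logk h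
    L = cut h i z
    B = halfThreshold h i
    F : ℕ → ℚ
    F j = a j i * z j
    threshold≡ : threshold h i ≡ B + B
    threshold≡ = trans (cong (λ m → ℕ→ℚ m * c i) (ℕP.*-distribʳ-+ l 5 5))
                       (trans (cong (_* c i) (ℕ→ℚ-+ (5 ℕ.* l) (5 ℕ.* l))) (*-distribʳ-+ (c i) (ℕ→ℚ (5 ℕ.* l)) (ℕ→ℚ (5 ℕ.* l))))
    B≤tail : B ≤ ΣFrom L h F
    B≤tail = remainder-≥ (subst₂ _≤_ threshold≡ (Σ<-split F (cut≤h h i z)) (<⇒≤ (≰⇒> fires)))
                         (largestPrefix-load i z B h (0≤* (ℕ→ℚ-nonNeg (5 ℕ.* l)) (<⇒≤ (c-pos i))))

  -- Under the potential bound, a cut followed by load ≥ 2 log k + 1 carries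
  -- weight at most c_i X / 2k, since 2^(2 log k + 1) = 2k².
  weight-bound : ∀ {h i L X y} → (∀ j → 0ℚ ≤ y j) → ℕ→ℚ (suc (logk h ℕ.+ logk h)) ≤ load h L y i →
                 Potential h i L X y → weight y L i * (K h + K h) ≤ c i * X
  weight-bound {h} {i} {L} {X} {y} 0≤y enough bound = *-cancelʳ-≤-0< (K h) (K-pos h) (begin
    W * (K h + K h) * K h           ≡⟨ solve 2 (λ W K → W :* (K :+ K) :* K := W :* (K :* K :+ K :* K)) refl W (K h) ⟩
    W * (K h * K h + K h * K h)     ≡⟨ cong (W *_) (sym (trans (pow2-suc (l ℕ.+ l)) (cong₂ _+_ (pow2-double l) (pow2-double l)))) ⟩
    W * pow2 (suc (l ℕ.+ l))        ≤⟨ expBound-at (suc (l ℕ.+ l)) (Σ<-nonNeg L (λ j _ → if-0-nonNeg ⌊ 0ℚ <? a j i ⌋ (0≤y j))) enough bound ⟩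
    K h * c i * X                   ≡⟨ solve 3 (λ K c X → K :* c :* X := c :* X :* K) refl (K h) (c i) X ⟩
    c i * X * K h                   ∎)
    where
    l = logk h
    W = weight y L i

  -- The loss of the dual objective caused by step (b)(ii) for one i ∈ T_h is at
  -- most d_{m(h)} / 2k: it is ρ_{hi} · weight ≤ ρ_{hi} c_i x_i / 2k = d_{m(h)} a_{ih} x_i / 2k,
  -- and a_{ih} x_i < 1 as long as constraint h was violated at the start.
  shrink-loss-bound : ∀ {h x y t z i} → Invariant h x y → cover h x < 1ℚ → 0ℚ < a h i →
                      Dominated h (raise y h t) z → ¬ (Σ< h (λ j → a j i * z j) ≤ threshold h i) →
                      (Σ< (suc h) z - Σ< (suc h) (shrink h i z)) * (K h + K h) ≤ dm h
  shrink-loss-bound {h} {x} {y} {t} {z} {i} I violated 0<a dom fires = begin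
    (Σ< (suc h) z - Σ< (suc h) (shrink h i z)) * (K h + K h)  ≡⟨ cong (_* (K h + K h)) (shrink-loss h i z) ⟩
    ρ h i * W * (K h + K h)       ≡⟨ *-assoc (ρ h i) W (K h + K h) ⟩
    ρ h i * (W * (K h + K h))     ≤⟨ *-monoˡ-≤-0≤ (ρ h i) (ρ-nonNeg 0<a) W-bound ⟩
    ρ h i * (c i * x i)           ≡⟨ sym (*-assoc (ρ h i) (c i) (x i)) ⟩
    ρ h i * c i * x i             ≡⟨ cong (_* x i) (ρ*c 0<a) ⟩
    dm h * a h i * x i            ≡⟨ *-assoc (dm h) (a h i) (x i) ⟩
    dm h * (a h i * x i)          ≤⟨ *-monoˡ-≤-0≤ (dm h) (dm-nonNeg h) ax≤1 ⟩
    dm h * 1ℚ                     ≡⟨ *-identityʳ (dm h) ⟩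
    dm h                          ∎
    where
    open Invariant I
    open Dominated dom
    L = cut h i z
    W = weight z L i
    z≤y : ∀ j → j ℕ.< h → z j ≤ y j
    z≤y j j<h = ≤-trans (below j j<h) (≤-reflexive (raise-below y h t j<h))
    W-bound : W * (K h + K h) ≤ c i * x i
    W-bound = weight-bound {h} {i} {L} {x i} {z} nonNeg (≤-trans (ℕ→ℚ-mono (1+2logk≤5logk h)) (cut-load {h} {i} {z} fires))
                (potential-antitone {h} {i} {L} {x i} {y} {z} (cut≤h h i z) nonNeg z≤y (potential i L (cut≤h h i z)))
    ax≤1 : a h i * x i ≤ 1ℚ
    ax≤1 = <⇒≤ (≤-<-trans (term≤cover h x x-nonNeg i) violated)

  dualStep-loss : ∀ {h x y t z i} → Invariant h x y → cover h x < 1ℚ → 0ℚ < a h i →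
                  Dominated h (raise y h t) z →
                  (Σ< (suc h) z - Σ< (suc h) (dualStepI h z i)) * (K h + K h) ≤ dm h
  dualStep-loss {h} {x} {y} {t} {z} {i} I violated 0<a dom = byCase (Σ< h (λ j → a j i * z j) ≤? threshold h i)
    where
    Loss≤dm : (ℕ → ℚ) → Set
    Loss≤dm w = (Σ< (suc h) z - Σ< (suc h) w) * (K h + K h) ≤ dm h
    byCase : Dec (Σ< h (λ j → a j i * z j) ≤ threshold h i) → Loss≤dm (dualStepI h z i)
    byCase (yes quiet) = subst Loss≤dm (sym (dualStep-quiet h z i quiet))
                           (subst (_≤ dm h) (sym ([p-p]*q≡0 (Σ< (suc h) z) (K h + K h))) (dm-nonNeg h))
    byCase (no fires)  = subst Loss≤dm (sym (dualStep-fires h z i fires)) (shrink-loss-bound {h} {x} {y} {t} {z} {i} I violated 0<a dom fires)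

  dualSteps-dominated : ∀ {h w} ord {z} → (∀ {i} → i ∈ ord → 0ℚ < a h i) →
                        Dominated h w z → Dominated h w (foldl (dualStepI h) z ord)
  dualSteps-dominated []        _      dom = dom
  dualSteps-dominated (i ∷ ord) active dom =
    dualSteps-dominated ord (λ i∈ → active (there i∈)) (dualStep-dominated (active (here refl)) dom)

  dualSteps-loss : ∀ {h x y t} → Invariant h x y → cover h x < 1ℚ → ∀ ord {z} →
                   (∀ {i} → i ∈ ord → 0ℚ < a h i) → Dominated h (raise y h t) z →
                   (Σ< (suc h) z - Σ< (suc h) (foldl (dualStepI h) z ord)) * (K h + K h) ≤ ℕ→ℚ (length ord) * dm h
  dualSteps-loss {h} I violated [] {z} _ _ =
    ≤-reflexive (trans ([p-p]*q≡0 (Σ< (suc h) z) (K h + K h)) (sym (*-zeroˡ (dm h))))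
  dualSteps-loss {h} {x} {y} {t} I violated (i ∷ ord) {z} active dom = begin
    (S₀ - S₂) * KK                      ≡⟨ solve 4 (λ a b c k → (a :- c) :* k := (a :- b) :* k :+ (b :- c) :* k) refl S₀ S₁ S₂ KK ⟩
    (S₀ - S₁) * KK + (S₁ - S₂) * KK     ≤⟨ +-mono-≤ (dualStep-loss {h} {x} {y} {t} {z} {i} I violated (active (here refl)) dom)
                                             (dualSteps-loss {h} {x} {y} {t} I violated ord (λ i∈ → active (there i∈))
                                               (dualStep-dominated (active (here refl)) dom)) ⟩
    dm h + ℕ→ℚ (length ord) * dm h      ≡⟨ solve 2 (λ m N → m :+ N :* m := (con 1ℚ :+ N) :* m) refl (dm h) (ℕ→ℚ (length ord)) ⟩
    (1ℚ + ℕ→ℚ (length ord)) * dm h      ≡⟨ cong (_* dm h) (sym (ℕ→ℚ-suc (length ord))) ⟩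
    ℕ→ℚ (length (i ∷ ord)) * dm h       ∎
    where
    KK = K h + K h
    S₀ = Σ< (suc h) z
    S₁ = Σ< (suc h) (dualStepI h z i)
    S₂ = Σ< (suc h) (foldl (dualStepI h) (dualStepI h z i) ord)

  ord-active : ∀ {h ord} → ord ↭ T h → ∀ {i} → i ∈ ord → 0ℚ < a h i
  ord-active perm i∈ord = T-pos (∈-resp-↭ perm i∈ord)

  raise-nonNeg : ∀ {h x y} → Invariant h x y → ∀ t j → 0ℚ ≤ raise y h t j
  raise-nonNeg {h} {x} {y} I t j = byCase (j ℕ.≟ h)
    where
    byCase : Dec (j ≡ h) → 0ℚ ≤ raise y h t j
    byCase (yes refl) = subst (0ℚ ≤_) (sym (raise-≡ y h t)) (0≤* (dm-nonNeg h) (ℕ→ℚ-nonNeg t))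
    byCase (no j≢h)   = subst (0ℚ ≤_) (sym (raise-≢ y h t j≢h)) (Invariant.y-nonNeg I j)

  raise-zero : ∀ {h x y} → Invariant h x y → ∀ j → raise y h 0 j ≡ y j
  raise-zero {h} {x} {y} I j = byCase (j ℕ.≟ h)
    where
    byCase : Dec (j ≡ h) → raise y h 0 j ≡ y j
    byCase (yes refl) = trans (raise-≡ y h 0) (trans (*-zeroʳ (dm h)) (sym (Invariant.y-unseen I h ℕP.≤-refl)))
    byCase (no j≢h)   = raise-≢ y h 0 j≢h

  dualUpdate-dominated : ∀ {h x y} → Invariant h x y → ∀ t {ord} → ord ↭ T h →
                         Dominated (suc h) (raise y h t) (dualUpdate h t ord y)
  dualUpdate-dominated {h} {x} {y} I zero _ = record
    { nonNeg = Invariant.y-nonNeg I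
    ; below  = λ j _ → ≤-reflexive (sym (raise-zero I j))
    ; above  = λ j _ → sym (raise-zero I j)
    }
  dualUpdate-dominated {h} {x} {y} I (suc t) {ord} perm = record
    { nonNeg = nonNeg
    ; below  = λ j j<h+1 → case-below j (ℕP.m≤n⇒m<n∨m≡n (ℕP.≤-pred j<h+1))
    ; above  = λ j h+1≤j → above j (ℕP.<⇒≤ h+1≤j)
    }
    where
    initial : Dominated h (raise y h (suc t)) (raise y h (suc t))
    initial = record { nonNeg = raise-nonNeg I (suc t) ; below = λ _ _ → ≤-refl ; above = λ _ _ → refl }
    open Dominated (dualSteps-dominated ord (ord-active perm) initial)
    case-below : ∀ j → (j ℕ.< h) ⊎ (j ≡ h) → dualUpdate h (suc t) ord y j ≤ raise y h (suc t) j
    case-below j (inj₁ j<h)  = below j j<h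
    case-below j (inj₂ refl) = ≤-reflexive (above j ℕP.≤-refl)

  invariant-next : ∀ {h x y} t {ord} → Invariant h x y → ord ↭ T h →
                   Invariant (suc h) (iter t (primalStep h) x) (dualUpdate h t ord y)
  invariant-next {h} {x} {y} t {ord} I perm = record
    { x-nonNeg  = λ i → subst (0ℚ ≤_) (sym (iter-primalStep h t x i)) (φ-nonNeg h i t (x-nonNeg i))
    ; y-nonNeg  = nonNeg
    ; y-unseen  = λ j h+1≤j → trans (above j h+1≤j)
                    (trans (raise-≢ y h t (λ j≡h → ℕP.<-irrefl (sym j≡h) h+1≤j)) (y-unseen j (ℕP.<⇒≤ h+1≤j)))
    ; potential = λ i L L≤h+1 → potential-antitone L≤h+1 nonNeg below (potential-next I t i L L≤h+1)
    }
    where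
    open Invariant I
    open Dominated (dualUpdate-dominated I t perm)

  reach-invariant : ∀ {h x y} → Reach h x y → Invariant h x y
  reach-invariant start                       = invariant-start
  reach-invariant (next t ord reach run perm) = invariant-next t (reach-invariant reach) perm

  -- Summing over the |T_h| ≤ k steps, the total loss Δ is at most d_{m(h)} / 2.
  dualUpdate-loss : ∀ {h x y} t {ord} → Invariant h x y → PrimalRun h x (suc t) → ord ↭ T h →
                    let Δ = Σ< (suc h) (raise y h (suc t)) - Σ< (suc h) (dualUpdate h (suc t) ord y)
                    in Δ + Δ ≤ dm h
  dualUpdate-loss {h} {x} {y} t {ord} I run perm = *-cancelʳ-≤-0< (K h) (K-pos h) (begin
    (Δ + Δ) * K h          ≡⟨ solve 2 (λ d k → (d :+ d) :* k := d :* (k :+ k)) refl Δ (K h) ⟩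
    Δ * (K h + K h)        ≤⟨ dualSteps-loss {h} {x} {y} {suc t} I violated ord (ord-active perm) initial ⟩
    ℕ→ℚ (length ord) * dm h ≤⟨ *-monoʳ-≤-0≤ (dm h) (dm-nonNeg h) |ord|≤K ⟩
    K h * dm h             ≡⟨ *-comm (K h) (dm h) ⟩
    dm h * K h             ∎)
    where
    Δ = Σ< (suc h) (raise y h (suc t)) - Σ< (suc h) (dualUpdate h (suc t) ord y)
    violated : cover h x < 1ℚ
    violated = proj₁ run 0 (s≤s z≤n)
    initial : Dominated h (raise y h (suc t)) (raise y h (suc t))
    initial = record { nonNeg = raise-nonNeg I (suc t) ; below = λ _ _ → ≤-refl ; above = λ _ _ → refl }
    |ord|≤K : ℕ→ℚ (length ord) ≤ K h
    |ord|≤K = subst (λ m → ℕ→ℚ m ≤ K h) (sym (↭-length perm)) (|T|≤K h)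

  net-gain : ∀ {h x y} t {ord} → Reach h x y → PrimalRun h x t → ord ↭ T h →
             ½ * (dm h * ℕ→ℚ t) ≤ Σ< (suc h) (dualUpdate h t ord y) - Σ< h y
  net-gain {h} {x} {y} zero reach _ _ = begin
    ½ * (dm h * 0ℚ)             ≡⟨ trans (cong (½ *_) (*-zeroʳ (dm h))) (*-zeroʳ ½) ⟩
    0ℚ                          ≤⟨ Invariant.y-nonNeg (reach-invariant reach) h ⟩
    y h                         ≡⟨ solve 2 (λ S v → v := S :+ v :- S) refl (Σ< h y) (y h) ⟩
    Σ< h y + y h - Σ< h y       ∎
  net-gain {h} {x} {y} (suc t) {ord} reach run perm = begin
    ½ * D                        ≤⟨ half-retained (≤-trans (dualUpdate-loss t I run perm) dm≤D) ⟩
    D - Δ                        ≡⟨ cong (λ e → D - (e - Σ< (suc h) y′)) raised-sum ⟩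
    D - (Σ< h y + D - Σ< (suc h) y′)
                                 ≡⟨ solve 3 (λ S D B → D :- (S :+ D :- B) := B :- S) refl (Σ< h y) D (Σ< (suc h) y′) ⟩
    Σ< (suc h) y′ - Σ< h y       ∎
    where
    I = reach-invariant reach
    D = dm h * ℕ→ℚ (suc t)
    y′ = dualUpdate h (suc t) ord y
    Δ = Σ< (suc h) (raise y h (suc t)) - Σ< (suc h) y′
    raised-sum : Σ< (suc h) (raise y h (suc t)) ≡ Σ< h y + D
    raised-sum = cong₂ _+_ (Σ<-cong h (λ j j<h → raise-below y h (suc t) j<h)) (raise-≡ y h (suc t))
    dm≤D : dm h ≤ D
    dm≤D = ≤-trans (≤-reflexive (sym (*-identityʳ (dm h))))
                   (*-monoˡ-≤-0≤ (dm h) (dm-nonNeg h) (ℕ→ℚ-mono {1} {suc t} (s≤s z≤n)))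

-- The theorem.
lemma6 : (n : ℕ) (c : Fin n → ℚ) (a : ℕ → Fin n → ℚ) →
    (∀ i → 0ℚ < c i) →
    (∀ j i → 0ℚ ≤ a j i) →
    (∀ j → ∃ λ i → 0ℚ < a j i) →
    ∀ (h : ℕ) (x : Fin n → ℚ) (y : ℕ → ℚ) (t : ℕ) (ord : List (Fin n)) →
    AlgorithmI.Reach n c a h x y →
    AlgorithmI.PrimalRun n c a h x t →
    ord ↭ AlgorithmI.T n c a h →
    ½ * (AlgorithmI.dm n c a h * ℕ→ℚ t)
      ≤ Σ< (suc h) (AlgorithmI.dualUpdate n c a h t ord y) - Σ< h y
lemma6 n c a c-pos a-nonNeg _ h x y t ord reach run perm =
  Analysis.net-gain n c a c-pos a-nonNeg t reach run perm
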